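{- Let $\mathcal S(Q,\omega)$ be a non-empty subword complex with greedy facet $G$ and antigreedy facet $\bar G$. Then (1) $e\in\mathcal L(G)$; (2) $\omega\in\mathcal L(\bar G)$; (3) if $I$ is a facet with $e\in\mathcal L(I)$, then $I=G$.
   Context: Let $\Phi$ be a finite root system with positive roots $\Phi^+$, simple roots $\Delta$, finite Coxeter group $W$ generated by simple reflections $S$; $\alpha_s$ is the simple root of $s\in S$; $e$ is the identity. Let $Q=(q_1,\dots,q_m)$ be a word on $S$ and $\omega\in W$. For $J\subseteq[m]$, $Q_J$ is the subword at positions in $J$. The subword complex $\mathcal S(Q,\omega)$ has facets the sets $I\subseteq[m]$ such that $Q_{[m]\setminus I}$ is a reduced expression of $\omega$. Two facets $I,J$ are related by a flip if $I\setminus\{i\}=J\setminus\{j\}$ with $i\neq j$; the flip from $I$ to $J$ is increasing if $i<j$. The increasing flip graph on facets has a unique source, the greedy facet $G$, and a unique sink, the antigreedy facet $\bar G$ (these are the lexicographically smallest and largest facets). Root function: $r(I,k)=\prod Q_{[k-1]\setminus I}(\alpha_{q_k})$ (product of the letters at positions in $[k-1]\setminus I$ in order, applied to $\alpha_{q_k}$). Root configuration $R(I)=\{r(I,i):i\in I\}$. Linear extensions: $\mathcal L(I)=\{\pi\in W:R(I)\subseteq\pi(\Phi^+)\}$. -}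

module Defs where

open import Level using (0ℓ)
open import Data.Nat using (ℕ; zero; suc) renaming (_≤_ to _≤ℕ_)
open import Data.Fin using (Fin; zero; suc) renaming (_<_ to _<F_)
open import Data.Fin.Subset using (Subset; _∈_; inside; outside)
open import Data.Vec using (Vec; []; _∷_; lookup)
open import Data.List using (List; []; _∷_; length; _++_)
open import Data.List.Relation.Unary.Any using (Any)
open import Data.Product using (Σ; _×_; ∃)
open import Data.Sum using (_⊎_)
open import Relation.Nullary using (¬_)
open import Relation.Binary.Core using (Rel)
open import Relation.Binary.Structures using (IsTotalOrder)
open import Relation.Binary.PropositionalEquality using (_≡_; _≢_)
open import Algebra.Core using (Op₁; Op₂)
open import Algebra.Structures using (IsCommutativeRing)

record OrderedField : Set₁ where
  infixl 6 _+_
  infixl 7 _*_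
  infix 4 _≈_ _≤_
  field
    Carrier : Set
    _≈_     : Rel Carrier 0ℓ
    _+_ _*_ : Op₂ Carrier
    -_      : Op₁ Carrier
    0# 1#   : Carrier
    isCommutativeRing : IsCommutativeRing _≈_ _+_ _*_ -_ 0# 1#
    _⁻¹     : Op₁ Carrier
    0≉1     : ¬ (0# ≈ 1#)
    ⁻¹-inverseʳ : ∀ x → ¬ (x ≈ 0#) → x * (x ⁻¹) ≈ 1#
    _≤_     : Rel Carrier 0ℓ
    isTotalOrder : IsTotalOrder _≈_ _≤_
    +-monoˡ-≤ : ∀ x y z → x ≤ y → x + z ≤ y + z
    *-nonneg  : ∀ x y → 0# ≤ x → 0# ≤ y → 0# ≤ x * y

module Space (F : OrderedField) (n : ℕ) where
  open OrderedField F

  V : Set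
  V = Fin n → Carrier

  infix 4 _≈V_
  _≈V_ : V → V → Set
  u ≈V v = ∀ i → u i ≈ v i

  0V : V
  0V _ = 0#

  negV : V → V
  negV v i = - (v i)

  sumF : ∀ {k} → (Fin k → Carrier) → Carrier
  sumF {zero}  f = 0#
  sumF {suc k} f = f zero + sumF (λ i → f (suc i))

  ⟨_,_⟩ : V → V → Carrier
  ⟨ u , v ⟩ = sumF (λ i → u i * v i)

  2# : Carrier
  2# = 1# + 1#

  reflect : V → V → V
  reflect α v i = v i + - ((2# * ⟨ v , α ⟩ * (⟨ α , α ⟩ ⁻¹)) * α i)

  _∈L_ : V → List V → Set
  v ∈L xs = Any (λ x → v ≈V x) xs

  lincomb : ∀ {r} → (Fin r → V) → (Fin r → Carrier) → V
  lincomb b c i = sumF (λ j → c j * b j i)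

  NonNegComb : ∀ {r} → (Fin r → V) → V → Set
  NonNegComb b v = Σ (Fin _ → Carrier) λ c → (∀ j → 0# ≤ c j) × (v ≈V lincomb b c)

-- A finite (reduced) root system Φ ⊂ F^n together with a simple system Δ
-- (Humphreys, Reflection groups and Coxeter groups, §1.2–1.3).

record RootSystem (F : OrderedField) (n : ℕ) : Set₁ where
  open OrderedField F
  open Space F n
  field
    roots    : List V
    nonzero  : ∀ α → α ∈L roots → ¬ (α ≈V 0V)
    closed   : ∀ α β → α ∈L roots → β ∈L roots → reflect α β ∈L roots
    reduced  : ∀ α c → α ∈L roots → (λ i → c * α i) ∈L roots → (c ≈ 1# ⊎ c ≈ - 1#)
    rank     : ℕ
    simple   : Fin rank → V
    simple∈  : ∀ s → simple s ∈L roots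
    simple-indep : ∀ c → lincomb simple c ≈V 0V → ∀ s → c s ≈ 0#
    simple-sign  : ∀ α → α ∈L roots → NonNegComb simple α ⊎ NonNegComb simple (negV α)

module RS {F : OrderedField} {n : ℕ} (R : RootSystem F n) where
  open OrderedField F
  open Space F n public
  open RootSystem R public

  S : Set
  S = Fin rank

  -- elements of W are represented by words; s₁ s₂ … s_t acts as s₁ ∘ s₂ ∘ … ∘ s_t
  Word : Set
  Word = List S

  act : Word → V → V
  act []      v = v
  act (s ∷ w) v = reflect (simple s) (act w v)

  -- equality in W (the reflection representation is faithful)
  infix 4 _≡W_
  _≡W_ : Word → Word → Set
  u ≡W v = ∀ x → act u x ≈V act v x

  IsReducedExpr : Word → Word → Set
  IsReducedExpr ω u = (u ≡W ω) × (∀ v → v ≡W ω → length u ≤ℕ length v)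

  IsPositiveRoot : V → Set
  IsPositiveRoot v = (v ∈L roots) × NonNegComb simple v

  complWord : ∀ {m} → Vec S m → Subset m → Word
  complWord []      []            = []
  complWord (q ∷ Q) (outside ∷ I) = q ∷ complWord Q I
  complWord (q ∷ Q) (inside ∷ I)  = complWord Q I

  -- Q_{[k-1] ∖ I}  (positions strictly before k, not in I)
  prefixComplWord : ∀ {m} → Vec S m → Subset m → Fin m → Word
  prefixComplWord (q ∷ Q) (b ∷ I)       zero    = []
  prefixComplWord (q ∷ Q) (outside ∷ I) (suc k) = q ∷ prefixComplWord Q I k
  prefixComplWord (q ∷ Q) (inside ∷ I)  (suc k) = prefixComplWord Q I k

  IsFacet : ∀ {m} → Vec S m → Word → Subset m → Set
  IsFacet Q ω I = IsReducedExpr ω (complWord Q I)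

  Flip : ∀ {m} → Subset m → Subset m → Fin m → Fin m → Set
  Flip {m} I J i j =
    (i ∈ I) × (j ∈ J) × (i ≢ j) ×
    (∀ (k : Fin m) → (((k ∈ I) × (k ≢ i)) → ((k ∈ J) × (k ≢ j)))
                   × (((k ∈ J) × (k ≢ j)) → ((k ∈ I) × (k ≢ i))))

  IncFlip : ∀ {m} → Subset m → Subset m → Set
  IncFlip {m} I J = Σ (Fin m) λ i → Σ (Fin m) λ j → Flip I J i j × (i <F j)

  IsGreedy : ∀ {m} → Vec S m → Word → Subset m → Set
  IsGreedy Q ω G = IsFacet Q ω G × (∀ J → IsFacet Q ω J → ¬ IncFlip J G)

  IsAntigreedy : ∀ {m} → Vec S m → Word → Subset m → Set
  IsAntigreedy Q ω G = IsFacet Q ω G × (∀ J → IsFacet Q ω J → ¬ IncFlip G J)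

  rootFun : ∀ {m} → Vec S m → Subset m → Fin m → V
  rootFun Q I k = act (prefixComplWord Q I k) (simple (lookup Q k))

  -- π ∈ L(I)  iff  R(I) ⊆ π(Φ⁺)
  LinExt : ∀ {m} → Vec S m → Subset m → Word → Set
  LinExt Q I π = ∀ i → i ∈ I → ∃ λ β → IsPositiveRoot β × (act π β ≈V rootFun Q I i)

-- Every root r(I, k) is the image of a simple root under a word, so it is either positive or
-- negative.  If a root of the greedy facet G were negative, the exchange condition would delete
-- an earlier letter of the prefix, and exchanging that position for k gives a facet with an
-- increasing flip into G; symmetrically, a root of the antigreedy facet that ω⁻¹ sends to a
-- negative root yields, via the exchange condition on the suffix, an increasing flip out of Ḡ.
-- Finally, if all roots of two facets I and J are positive, then at the last position where they
-- differ the facet containing it would give a reduced word x·s·u with x αₛ positive and x = y s,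
-- which forces y αₛ to be both positive and negative; hence I = J = G.
module Submission where

open import Defs
open import Data.Nat using (ℕ)
open import Data.Fin.Subset using (Subset)
open import Data.Vec using (Vec)
open import Data.List using ([])
open import Data.Product using (_×_; ∃)
open import Relation.Binary.PropositionalEquality using (_≡_)

open import Level using (0ℓ)
open import Algebra.Bundles using (CommutativeRing)
open import Algebra.Structures using (IsCommutativeRing)
open import Data.Bool using (Bool)
open import Data.Empty using (⊥; ⊥-elim)
open import Data.Fin as Fin using (Fin; zero; suc)
import Data.Fin.Properties as Fin
open import Data.Fin.Subset using (_∈_; inside; outside)
open import Data.Integer as ℤ using (ℤ; +_; -[1+_]; sign; ∣_∣)
import Data.Integer.Properties as ℤ
open import Data.List using (List; _∷_; _++_; length; reverse; [_])
import Data.List.Properties as List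
import Data.List.Relation.Unary.Any as Any
open import Data.Maybe using (Maybe; nothing; just)
import Data.Nat as ℕ
open import Data.Nat using (zero; suc)
import Data.Nat.Properties as ℕ
open import Data.Product using (_,_; Σ; proj₁; proj₂)
import Data.Sign as Sign
import Data.Sum as Sum
open import Data.Sum using (_⊎_; inj₁; inj₂)
open import Data.Vec using ([]; _∷_; lookup; _[_]≔_; _[_]=_; here; there)
import Data.Vec.Properties as Vec
open import Function using (_∘_)
open import Relation.Binary.Bundles using (Setoid)
import Relation.Binary.PropositionalEquality as ≡
open import Relation.Binary.PropositionalEquality using (_≢_)
import Relation.Binary.Reasoning.Setoid
open import Relation.Binary.Structures using (IsTotalOrder)
open import Relation.Nullary using (¬_; yes; no)

module IntegerCoefficients (F : OrderedField) where
  open OrderedField F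
  open import Algebra.Solver.Ring.AlmostCommutativeRing
    using (fromCommutativeRing; _-Raw-AlmostCommutative⟶_)

  commutativeRing : CommutativeRing 0ℓ 0ℓ
  commutativeRing = record { isCommutativeRing = isCommutativeRing }

  open CommutativeRing commutativeRing
    using (setoid; refl; sym; trans; +-cong; *-cong; -‿cong; +-comm; +-identityʳ; +-identityˡ; *-identityˡ; *-identityʳ;
           -‿inverseʳ; zeroʳ; ring; semiring; +-abelianGroup; +-commutativeSemigroup; *-commutativeSemigroup)
  open import Algebra.Properties.Ring ring using (-1*x≈-x)
  open import Algebra.Properties.CommutativeSemigroup *-commutativeSemigroup using () renaming (interchange to *-interchange)
  open import Algebra.Properties.CommutativeSemigroup +-commutativeSemigroup using () renaming (interchange to +-interchange)
  open import Algebra.Properties.AbelianGroup +-abelianGroup using (⁻¹-∙-comm; ⁻¹-involutive; ε⁻¹≈ε)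
  open import Algebra.Properties.Semiring.Mult semiring using (×-homo-+; ×1-homo-*; ×-homo-1) renaming (_×_ to _×′_)
  open import Relation.Binary.Reasoning.Setoid setoid

  -- Unlike the library's n ×′ 1#, which ends in + 0#, this sends 1 to 1# and 2 to 1# + 1#
  -- definitionally, so that the solver's literals match 1# and the 2# in the definition of reflect.
  fromℕ : ℕ → Carrier
  fromℕ zero          = 0#
  fromℕ (suc zero)    = 1#
  fromℕ (suc (suc n)) = 1# + fromℕ (suc n)

  fromℕ≈×1# : ∀ n → fromℕ n ≈ n ×′ 1#
  fromℕ≈×1# zero          = refl
  fromℕ≈×1# (suc zero)    = sym (×-homo-1 1#)
  fromℕ≈×1# (suc (suc n)) = +-cong refl (fromℕ≈×1# (suc n))

  fromℕ-homo-+ : ∀ m n → fromℕ (m ℕ.+ n) ≈ fromℕ m + fromℕ n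
  fromℕ-homo-+ m n = trans (fromℕ≈×1# (m ℕ.+ n))
    (trans (×-homo-+ 1# m n) (sym (+-cong (fromℕ≈×1# m) (fromℕ≈×1# n))))

  fromℕ-homo-* : ∀ m n → fromℕ (m ℕ.* n) ≈ fromℕ m * fromℕ n
  fromℕ-homo-* m n = trans (fromℕ≈×1# (m ℕ.* n))
    (trans (×1-homo-* m n) (sym (*-cong (fromℕ≈×1# m) (fromℕ≈×1# n))))

  fromℕ-suc : ∀ n → fromℕ (suc n) ≈ 1# + fromℕ n
  fromℕ-suc = fromℕ-homo-+ 1

  ⟦_⟧ : ℤ → Carrier
  ⟦ + n ⟧      = fromℕ n
  ⟦ -[1+ n ] ⟧ = - fromℕ (suc n)

  ⟦sign⟧ : Sign.Sign → Carrier
  ⟦sign⟧ Sign.+ = 1#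
  ⟦sign⟧ Sign.- = - 1#

  ⟦sign⟧-homo-* : ∀ s t → ⟦sign⟧ (s Sign.* t) ≈ ⟦sign⟧ s * ⟦sign⟧ t
  ⟦sign⟧-homo-* Sign.+ t      = sym (*-identityˡ _)
  ⟦sign⟧-homo-* Sign.- Sign.+ = sym (*-identityʳ _)
  ⟦sign⟧-homo-* Sign.- Sign.- = sym (trans (-1*x≈-x _) (⁻¹-involutive _))

  ⟦◃⟧ : ∀ s n → ⟦ s ℤ.◃ n ⟧ ≈ ⟦sign⟧ s * fromℕ n
  ⟦◃⟧ s      zero    = sym (zeroʳ _)
  ⟦◃⟧ Sign.+ (suc n) = sym (*-identityˡ _)
  ⟦◃⟧ Sign.- (suc n) = sym (-1*x≈-x _)

  ⟦⟧-signAbs : ∀ i → ⟦ i ⟧ ≈ ⟦sign⟧ (sign i) * fromℕ ∣ i ∣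
  ⟦⟧-signAbs i = ≡.subst (λ j → ⟦ j ⟧ ≈ ⟦sign⟧ (sign i) * fromℕ ∣ i ∣) (ℤ.◃-inverse i) (⟦◃⟧ (sign i) ∣ i ∣)

  ⟦⟧-homo-* : ∀ i j → ⟦ i ℤ.* j ⟧ ≈ ⟦ i ⟧ * ⟦ j ⟧
  ⟦⟧-homo-* i j = begin
    ⟦ (sign i Sign.* sign j) ℤ.◃ (∣ i ∣ ℕ.* ∣ j ∣) ⟧  ≈⟨ ⟦◃⟧ (sign i Sign.* sign j) (∣ i ∣ ℕ.* ∣ j ∣) ⟩
    ⟦sign⟧ (sign i Sign.* sign j) * fromℕ (∣ i ∣ ℕ.* ∣ j ∣)
      ≈⟨ *-cong (⟦sign⟧-homo-* (sign i) (sign j)) (fromℕ-homo-* ∣ i ∣ ∣ j ∣) ⟩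
    (⟦sign⟧ (sign i) * ⟦sign⟧ (sign j)) * (fromℕ ∣ i ∣ * fromℕ ∣ j ∣) ≈⟨ *-interchange _ _ _ _ ⟩
    (⟦sign⟧ (sign i) * fromℕ ∣ i ∣) * (⟦sign⟧ (sign j) * fromℕ ∣ j ∣) ≈⟨ *-cong (⟦⟧-signAbs i) (⟦⟧-signAbs j) ⟨
    ⟦ i ⟧ * ⟦ j ⟧ ∎

  ⟦⟧-homo-neg : ∀ i → ⟦ ℤ.- i ⟧ ≈ - ⟦ i ⟧
  ⟦⟧-homo-neg (+ zero)  = sym ε⁻¹≈ε
  ⟦⟧-homo-neg (+ suc n) = refl
  ⟦⟧-homo-neg -[1+ n ]  = sym (⁻¹-involutive _)

  1+a-[1+b]≈a-b : ∀ a b → (1# + a) + - (1# + b) ≈ a + - b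
  1+a-[1+b]≈a-b a b = begin
    (1# + a) + - (1# + b)    ≈⟨ +-cong refl (⁻¹-∙-comm _ _) ⟨
    (1# + a) + (- 1# + - b)  ≈⟨ +-interchange _ _ _ _ ⟩
    (1# + - 1#) + (a + - b)  ≈⟨ +-cong (-‿inverseʳ _) refl ⟩
    0# + (a + - b)           ≈⟨ +-identityˡ _ ⟩
    a + - b ∎

  ⟦⊖⟧ : ∀ m n → ⟦ m ℤ.⊖ n ⟧ ≈ fromℕ m + - fromℕ n
  ⟦⊖⟧ m       zero    = trans (sym (+-identityʳ _)) (+-cong refl (sym ε⁻¹≈ε))
  ⟦⊖⟧ zero    (suc n) = sym (+-identityˡ _)
  ⟦⊖⟧ (suc m) (suc n) = begin
    ⟦ suc m ℤ.⊖ suc n ⟧                  ≡⟨ ≡.cong ⟦_⟧ (ℤ.[1+m]⊖[1+n]≡m⊖n m n) ⟩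
    ⟦ m ℤ.⊖ n ⟧                          ≈⟨ ⟦⊖⟧ m n ⟩
    fromℕ m + - fromℕ n                  ≈⟨ 1+a-[1+b]≈a-b _ _ ⟨
    (1# + fromℕ m) + - (1# + fromℕ n)    ≈⟨ +-cong (fromℕ-suc m) (-‿cong (fromℕ-suc n)) ⟨
    fromℕ (suc m) + - fromℕ (suc n) ∎

  ⟦⟧-homo-+ : ∀ i j → ⟦ i ℤ.+ j ⟧ ≈ ⟦ i ⟧ + ⟦ j ⟧
  ⟦⟧-homo-+ (+ m)    (+ n)    = fromℕ-homo-+ m n
  ⟦⟧-homo-+ (+ m)    -[1+ n ] = ⟦⊖⟧ m (suc n)
  ⟦⟧-homo-+ -[1+ m ] (+ n)    = trans (⟦⊖⟧ n (suc m)) (+-comm _ _)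
  ⟦⟧-homo-+ -[1+ m ] -[1+ n ] = begin
    - fromℕ (suc (suc (m ℕ.+ n)))          ≡⟨ ≡.cong (λ k → - fromℕ (suc k)) (ℕ.+-suc m n) ⟨
    - fromℕ (suc m ℕ.+ suc n)              ≈⟨ -‿cong (fromℕ-homo-+ (suc m) (suc n)) ⟩
    - (fromℕ (suc m) + fromℕ (suc n))      ≈⟨ ⁻¹-∙-comm _ _ ⟨
    - fromℕ (suc m) + - fromℕ (suc n) ∎

  ⟦⟧-homomorphism : ℤ.+-*-rawRing -Raw-AlmostCommutative⟶ fromCommutativeRing commutativeRing
  ⟦⟧-homomorphism = record
    { ⟦_⟧ = ⟦_⟧ ; +-homo = ⟦⟧-homo-+ ; *-homo = ⟦⟧-homo-* ; -‿homo = ⟦⟧-homo-neg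
    ; 0-homo = refl ; 1-homo = refl }

  ⟦⟧-≟ : ∀ i j → Maybe (⟦ i ⟧ ≈ ⟦ j ⟧)
  ⟦⟧-≟ i j with i ℤ.≟ j
  ... | yes ≡.refl = just refl
  ... | no _       = nothing

  open import Algebra.Solver.Ring ℤ.+-*-rawRing (fromCommutativeRing commutativeRing) ⟦⟧-homomorphism ⟦⟧-≟ public
    using (solve; _:=_; _:+_; _:*_; :-_; _:-_; con)

module OrderedFieldProperties (F : OrderedField) where
  open OrderedField F
  open IntegerCoefficients F using (solve; _:=_; _:+_; _:*_; :-_; con)
  open IsCommutativeRing isCommutativeRing using (refl; trans; +-cong; *-cong; setoid)
  open IsTotalOrder isTotalOrder using (antisym; total; ≤-resp-≈) renaming (trans to ≤-trans; reflexive to ≤-reflexive)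
  open import Relation.Binary.Reasoning.Setoid setoid

  ≤-resp₂ : ∀ {x x′ y y′} → x ≈ x′ → y ≈ y′ → x ≤ y → x′ ≤ y′
  ≤-resp₂ x≈x′ y≈y′ x≤y = proj₁ ≤-resp-≈ y≈y′ (proj₂ ≤-resp-≈ x≈x′ x≤y)

  ≤0⇒-nonneg : ∀ {x} → x ≤ 0# → 0# ≤ - x
  ≤0⇒-nonneg {x} x≤0 = ≤-resp₂ (solve 1 (λ x → x :+ (:- x) := con (+ 0)) refl x)
                               (solve 1 (λ x → con (+ 0) :+ (:- x) := (:- x)) refl x)
                               (+-monoˡ-≤ x 0# (- x) x≤0)

  square-nonneg : ∀ x → 0# ≤ x * x
  square-nonneg x with total 0# x
  ... | inj₁ 0≤x = *-nonneg x x 0≤x 0≤x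
  ... | inj₂ x≤0 = ≤-resp₂ refl (solve 1 (λ x → (:- x) :* (:- x) := x :* x) refl x)
                     (*-nonneg (- x) (- x) (≤0⇒-nonneg x≤0) (≤0⇒-nonneg x≤0))

  0≤1 : 0# ≤ 1#
  0≤1 = ≤-resp₂ refl (solve 0 (con (+ 1) :* con (+ 1) := con (+ 1)) refl) (square-nonneg 1#)

  0≤0 : 0# ≤ 0#
  0≤0 = ≤-reflexive refl

  x≤x+nonneg : ∀ {x y} → 0# ≤ y → x ≤ x + y
  x≤x+nonneg {x} {y} 0≤y = ≤-resp₂ (solve 1 (λ x → con (+ 0) :+ x := x) refl x)
                                   (solve 2 (λ x y → y :+ x := x :+ y) refl x y)
                                   (+-monoˡ-≤ 0# y x 0≤y)

  +-nonneg : ∀ {x y} → 0# ≤ x → 0# ≤ y → 0# ≤ x + y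
  +-nonneg 0≤x 0≤y = ≤-trans 0≤x (x≤x+nonneg 0≤y)

  nonneg-+≈0⇒≈0 : ∀ {x y} → 0# ≤ x → 0# ≤ y → x + y ≈ 0# → x ≈ 0#
  nonneg-+≈0⇒≈0 0≤x 0≤y x+y≈0 = antisym (≤-resp₂ refl x+y≈0 (x≤x+nonneg 0≤y)) 0≤x

  nonneg-±1⇒1 : ∀ {x} → 0# ≤ x → x ≈ 1# ⊎ x ≈ - 1# → x ≈ 1#
  nonneg-±1⇒1 0≤x (inj₁ x≈1)        = x≈1
  nonneg-±1⇒1 {x} 0≤x (inj₂ x≈-1) = ⊥-elim (0≉1 (antisym 0≤1 1≤0))
    where
    1≤0 : 1# ≤ 0#
    1≤0 = ≤-resp₂ (solve 0 (con (+ 0) :+ con (+ 1) := con (+ 1)) refl)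
                  (trans (+-cong x≈-1 refl) (solve 0 ((:- con (+ 1)) :+ con (+ 1) := con (+ 0)) refl))
                  (+-monoˡ-≤ 0# x 1# 0≤x)

  ⁻¹-cong : ∀ {x y} → ¬ (x ≈ 0#) → x ≈ y → x ⁻¹ ≈ y ⁻¹
  ⁻¹-cong {x} {y} x≉0 x≈y = begin
    x ⁻¹               ≈⟨ solve 1 (λ a → a := a :* con (+ 1)) refl (x ⁻¹) ⟩
    x ⁻¹ * 1#          ≈⟨ *-cong refl (⁻¹-inverseʳ y (λ y≈0 → x≉0 (trans x≈y y≈0))) ⟨
    x ⁻¹ * (y * y ⁻¹)  ≈⟨ solve 3 (λ a b c → a :* (b :* c) := (b :* a) :* c) refl (x ⁻¹) y (y ⁻¹) ⟩
    (y * x ⁻¹) * y ⁻¹  ≈⟨ *-cong (*-cong x≈y refl) refl ⟨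
    (x * x ⁻¹) * y ⁻¹  ≈⟨ *-cong (⁻¹-inverseʳ x x≉0) refl ⟩
    1# * y ⁻¹          ≈⟨ solve 1 (λ a → con (+ 1) :* a := a) refl (y ⁻¹) ⟩
    y ⁻¹ ∎

  square≈0⇒¬¬≈0 : ∀ {x} → x * x ≈ 0# → ¬ ¬ (x ≈ 0#)
  square≈0⇒¬¬≈0 {x} x²≈0 x≉0 = x≉0 (begin
    x                  ≈⟨ solve 1 (λ a → a := a :* con (+ 1)) refl x ⟩
    x * 1#             ≈⟨ *-cong refl (⁻¹-inverseʳ x x≉0) ⟨
    x * (x * x ⁻¹)     ≈⟨ solve 2 (λ a b → a :* (a :* b) := (a :* a) :* b) refl x (x ⁻¹) ⟩
    (x * x) * x ⁻¹     ≈⟨ *-cong x²≈0 refl ⟩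
    0# * x ⁻¹          ≈⟨ solve 1 (λ b → con (+ 0) :* b := con (+ 0)) refl (x ⁻¹) ⟩
    0# ∎)

module EuclideanSpace (F : OrderedField) (n : ℕ) where
  open OrderedField F
  open Space F n
  open OrderedFieldProperties F
  open IntegerCoefficients F using (solve; _:=_; _:+_; _:*_; :-_; _:-_; con)
  open IsCommutativeRing isCommutativeRing using (refl; sym; trans; +-cong; *-cong; -‿cong; setoid)
  open import Relation.Binary.Reasoning.Setoid setoid

  sumF-cong : ∀ {k} {f g : Fin k → Carrier} → (∀ i → f i ≈ g i) → sumF f ≈ sumF g
  sumF-cong {zero}  f≈g = refl
  sumF-cong {suc k} f≈g = +-cong (f≈g zero) (sumF-cong (λ i → f≈g (suc i)))

  sumF-+ : ∀ {k} (f g : Fin k → Carrier) → sumF (λ i → f i + g i) ≈ sumF f + sumF g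
  sumF-+ {zero}  f g = solve 0 (con (+ 0) := con (+ 0) :+ con (+ 0)) refl
  sumF-+ {suc k} f g = trans (+-cong refl (sumF-+ (λ i → f (suc i)) (λ i → g (suc i))))
    (solve 4 (λ a b c d → (a :+ b) :+ (c :+ d) := (a :+ c) :+ (b :+ d)) refl (f zero) (g zero) _ _)

  sumF-*ˡ : ∀ {k} c (f : Fin k → Carrier) → sumF (λ i → c * f i) ≈ c * sumF f
  sumF-*ˡ {zero}  c f = solve 1 (λ c → con (+ 0) := c :* con (+ 0)) refl c
  sumF-*ˡ {suc k} c f = trans (+-cong refl (sumF-*ˡ c (λ i → f (suc i))))
    (solve 3 (λ c a s → c :* a :+ c :* s := c :* (a :+ s)) refl c (f zero) _)

  sumF-neg : ∀ {k} (f : Fin k → Carrier) → sumF (λ i → - f i) ≈ - sumF f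
  sumF-neg {zero}  f = solve 0 (con (+ 0) := :- con (+ 0)) refl
  sumF-neg {suc k} f = trans (+-cong refl (sumF-neg (λ i → f (suc i))))
    (solve 2 (λ a s → (:- a) :+ (:- s) := :- (a :+ s)) refl (f zero) _)

  sumF-0* : ∀ {k} (f : Fin k → Carrier) → sumF (λ i → 0# * f i) ≈ 0#
  sumF-0* f = trans (sumF-*ˡ 0# f) (solve 1 (λ s → con (+ 0) :* s := con (+ 0)) refl _)

  sumF-nonneg : ∀ {k} (f : Fin k → Carrier) → (∀ i → 0# ≤ f i) → 0# ≤ sumF f
  sumF-nonneg {zero}  f 0≤f = 0≤0
  sumF-nonneg {suc k} f 0≤f = +-nonneg (0≤f zero) (sumF-nonneg (λ i → f (suc i)) (λ i → 0≤f (suc i)))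

  sumF-nonneg-≈0 : ∀ {k} (f : Fin k → Carrier) → (∀ i → 0# ≤ f i) → sumF f ≈ 0# → ∀ i → f i ≈ 0#
  sumF-nonneg-≈0 f 0≤f Σf≈0 zero = nonneg-+≈0⇒≈0 (0≤f zero) (sumF-nonneg _ (λ i → 0≤f (suc i))) Σf≈0
  sumF-nonneg-≈0 f 0≤f Σf≈0 (suc i) =
    sumF-nonneg-≈0 (λ i → f (suc i)) (λ i → 0≤f (suc i))
      (nonneg-+≈0⇒≈0 (sumF-nonneg _ (λ i → 0≤f (suc i))) (0≤f zero)
        (trans (solve 2 (λ a b → b :+ a := a :+ b) refl (f zero) _) Σf≈0)) i

  single : ∀ {k} → Fin k → Carrier → Fin k → Carrier
  single zero    a zero    = a
  single zero    a (suc j) = 0#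
  single (suc s) a zero    = 0#
  single (suc s) a (suc j) = single s a j

  single-≡ : ∀ {k} (s : Fin k) a → single s a s ≡ a
  single-≡ zero    a = ≡.refl
  single-≡ (suc s) a = single-≡ s a

  single-≢ : ∀ {k} {s j : Fin k} a → j ≢ s → single s a j ≡ 0#
  single-≢ {s = zero}  {zero}  a j≢s = ⊥-elim (j≢s ≡.refl)
  single-≢ {s = zero}  {suc j} a j≢s = ≡.refl
  single-≢ {s = suc s} {zero}  a j≢s = ≡.refl
  single-≢ {s = suc s} {suc j} a j≢s = single-≢ a (λ j≡s → j≢s (≡.cong suc j≡s))

  single-nonneg : ∀ {k} (s : Fin k) {a} → 0# ≤ a → ∀ j → 0# ≤ single s a j
  single-nonneg zero    0≤a zero    = 0≤a
  single-nonneg zero    0≤a (suc j) = 0≤0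
  single-nonneg (suc s) 0≤a zero    = 0≤0
  single-nonneg (suc s) 0≤a (suc j) = single-nonneg s 0≤a j

  sumF-single : ∀ {k} (s : Fin k) a (f : Fin k → Carrier) → sumF (λ j → single s a j * f j) ≈ a * f s
  sumF-single zero    a f = trans (+-cong refl (sumF-0* (λ j → f (suc j))))
    (solve 1 (λ x → x :+ con (+ 0) := x) refl _)
  sumF-single (suc s) a f = trans (+-cong refl (sumF-single s a (λ j → f (suc j))))
    (solve 2 (λ y x → con (+ 0) :* y :+ x := x) refl (f zero) _)

  lincomb-+ : ∀ {k} (b : Fin k → V) c d → lincomb b (λ j → c j + d j) ≈V (λ i → lincomb b c i + lincomb b d i)
  lincomb-+ b c d i = trans (sumF-cong (λ j → solve 3 (λ x y z → (x :+ y) :* z := x :* z :+ y :* z) refl (c j) (d j) (b j i)))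
                            (sumF-+ (λ j → c j * b j i) (λ j → d j * b j i))

  lincomb-neg : ∀ {k} (b : Fin k → V) c → lincomb b (λ j → - c j) ≈V negV (lincomb b c)
  lincomb-neg b c i = trans (sumF-cong (λ j → solve 2 (λ x z → (:- x) :* z := :- (x :* z)) refl (c j) (b j i)))
                            (sumF-neg (λ j → c j * b j i))

  lincomb-cong : ∀ {k} (b : Fin k → V) {c d} → (∀ j → c j ≈ d j) → lincomb b c ≈V lincomb b d
  lincomb-cong b c≈d i = sumF-cong (λ j → *-cong (c≈d j) refl)

  lincomb-single : ∀ {k} (b : Fin k → V) s a → lincomb b (single s a) ≈V (λ i → a * b s i)
  lincomb-single b s a i = sumF-single s a (λ j → b j i)

  ¬¬-∀Fin : ∀ {k} {P : Fin k → Set} → (∀ i → ¬ ¬ P i) → ¬ ¬ (∀ i → P i)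
  ¬¬-∀Fin {zero}  ¬¬P ¬∀P = ¬∀P (λ ())
  ¬¬-∀Fin {suc k} ¬¬P ¬∀P = ¬¬P zero (λ P0 → ¬¬-∀Fin (λ i → ¬¬P (suc i))
                              (λ Psuc → ¬∀P (λ { zero → P0 ; (suc i) → Psuc i })))

  ≈V-setoid : Setoid 0ℓ 0ℓ
  ≈V-setoid = record
    { Carrier = V ; _≈_ = _≈V_
    ; isEquivalence = record
      { refl = λ i → refl ; sym = λ u≈v i → sym (u≈v i) ; trans = λ u≈v v≈w i → trans (u≈v i) (v≈w i) } }

  ⟨⟩-cong : ∀ {u u′ v v′} → u ≈V u′ → v ≈V v′ → ⟨ u , v ⟩ ≈ ⟨ u′ , v′ ⟩
  ⟨⟩-cong u≈u′ v≈v′ = sumF-cong (λ i → *-cong (u≈u′ i) (v≈v′ i))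

  ⟨⟩-sym : ∀ u v → ⟨ u , v ⟩ ≈ ⟨ v , u ⟩
  ⟨⟩-sym u v = sumF-cong (λ i → solve 2 (λ a b → a :* b := b :* a) refl (u i) (v i))

  ⟨⟩-linearˡ : ∀ u c w v → ⟨ (λ i → u i + c * w i) , v ⟩ ≈ ⟨ u , v ⟩ + c * ⟨ w , v ⟩
  ⟨⟩-linearˡ u c w v = begin
    ⟨ (λ i → u i + c * w i) , v ⟩
      ≈⟨ sumF-cong (λ i → solve 4 (λ a c b x → (a :+ c :* b) :* x := a :* x :+ c :* (b :* x)) refl (u i) c (w i) (v i)) ⟩
    sumF (λ i → u i * v i + c * (w i * v i)) ≈⟨ sumF-+ (λ i → u i * v i) (λ i → c * (w i * v i)) ⟩
    ⟨ u , v ⟩ + sumF (λ i → c * (w i * v i)) ≈⟨ +-cong refl (sumF-*ˡ c (λ i → w i * v i)) ⟩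
    ⟨ u , v ⟩ + c * ⟨ w , v ⟩ ∎

  ⟨⟩-negˡ : ∀ u v → ⟨ negV u , v ⟩ ≈ - ⟨ u , v ⟩
  ⟨⟩-negˡ u v = trans (sumF-cong (λ i → solve 2 (λ a b → (:- a) :* b := :- (a :* b)) refl (u i) (v i)))
                     (sumF-neg (λ i → u i * v i))

  ≉0V⇒⟨⟩≉0 : ∀ {α} → ¬ (α ≈V 0V) → ¬ (⟨ α , α ⟩ ≈ 0#)
  ≉0V⇒⟨⟩≉0 {α} α≉0 ⟨α,α⟩≈0 = ¬¬-∀Fin (λ i → square≈0⇒¬¬≈0 (α²≈0 i)) α≉0
    where
    α²≈0 : ∀ i → α i * α i ≈ 0#
    α²≈0 = sumF-nonneg-≈0 (λ i → α i * α i) (λ i → square-nonneg (α i)) ⟨α,α⟩≈0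

  -- ⟨v, α^∨⟩, so that s_α v = v − pairing α v · α
  pairing : V → V → Carrier
  pairing α v = 2# * ⟨ v , α ⟩ * (⟨ α , α ⟩ ⁻¹)

  pairing-cong : ∀ α {u v} → u ≈V v → pairing α u ≈ pairing α v
  pairing-cong α u≈v = *-cong (*-cong refl (⟨⟩-cong u≈v (λ i → refl))) refl

  pairing-linear : ∀ α u c w → pairing α (λ i → u i + c * w i) ≈ pairing α u + c * pairing α w
  pairing-linear α u c w = trans (*-cong (*-cong refl (⟨⟩-linearˡ u c w α)) refl)
    (solve 4 (λ p c q I → con (+ 2) :* (p :+ c :* q) :* I := con (+ 2) :* p :* I :+ c :* (con (+ 2) :* q :* I))
      refl _ c _ _)

  pairing-self : ∀ {α} → ¬ (⟨ α , α ⟩ ≈ 0#) → pairing α α ≈ 2#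
  pairing-self {α} α≉0 = begin
    2# * N * N ⁻¹    ≈⟨ solve 3 (λ t a b → t :* a :* b := t :* (a :* b)) refl 2# N (N ⁻¹) ⟩
    2# * (N * N ⁻¹)  ≈⟨ *-cong refl (⁻¹-inverseʳ N α≉0) ⟩
    2# * 1#          ≈⟨ solve 1 (λ t → t :* con (+ 1) := t) refl 2# ⟩
    2# ∎
    where N = ⟨ α , α ⟩

  reflect-cong : ∀ α {u v} → u ≈V v → reflect α u ≈V reflect α v
  reflect-cong α u≈v i = +-cong (u≈v i) (-‿cong (*-cong (pairing-cong α u≈v) refl))

  reflect-as-sum : ∀ α v → reflect α v ≈V (λ i → v i + - pairing α v * α i)
  reflect-as-sum α v i = solve 3 (λ a k b → a :+ (:- (k :* b)) := a :+ (:- k) :* b) refl (v i) (pairing α v) (α i)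

  reflect-linear : ∀ α u c w → reflect α (λ i → u i + c * w i) ≈V (λ i → reflect α u i + c * reflect α w i)
  reflect-linear α u c w i = trans (+-cong refl (-‿cong (*-cong (pairing-linear α u c w) refl)))
    (solve 6 (λ a c b ku kw x → (a :+ c :* b) :+ (:- ((ku :+ c :* kw) :* x))
                                := (a :+ (:- (ku :* x))) :+ c :* (b :+ (:- (kw :* x))))
      refl (u i) c (w i) (pairing α u) (pairing α w) (α i))

  reflect-neg : ∀ α v → reflect α (negV v) ≈V negV (reflect α v)
  reflect-neg α v i = trans (+-cong refl (-‿cong (*-cong (*-cong (*-cong refl (⟨⟩-negˡ v α)) refl) refl)))
    (solve 4 (λ a p I x → (:- a) :+ (:- (con (+ 2) :* (:- p) :* I :* x)) := :- (a :+ (:- (con (+ 2) :* p :* I :* x))))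
      refl (v i) ⟨ v , α ⟩ _ (α i))

  reflect-self : ∀ {α} → ¬ (⟨ α , α ⟩ ≈ 0#) → reflect α α ≈V negV α
  reflect-self {α} α≉0 i = trans (+-cong refl (-‿cong (*-cong (pairing-self α≉0) refl)))
    (solve 1 (λ a → a :+ (:- (con (+ 2) :* a)) := :- a) refl (α i))

  pairing-reflect : ∀ {α} v → ¬ (⟨ α , α ⟩ ≈ 0#) → pairing α (reflect α v) ≈ - pairing α v
  pairing-reflect {α} v α≉0 = begin
    2# * ⟨ reflect α v , α ⟩ * I
      ≈⟨ *-cong (*-cong refl (trans (⟨⟩-cong (reflect-as-sum α v) (λ i → refl)) (⟨⟩-linearˡ v (- pairing α v) α α))) refl ⟩
    2# * (p + - (2# * p * I) * N) * I     ≈⟨ solve 3 (λ p N I → con (+ 2) :* (p :+ (:- (con (+ 2) :* p :* I)) :* N) :* I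
                                              := (:- (con (+ 2) :* p :* I)) :+ (con (+ 4) :* p :* I) :* (con (+ 1) :- N :* I))
                                             refl p N I ⟩
    - (2# * p * I) + 4′ * p * I * (1# + - (N * I))
      ≈⟨ +-cong refl (*-cong refl (+-cong refl (-‿cong (⁻¹-inverseʳ N α≉0)))) ⟩
    - (2# * p * I) + 4′ * p * I * (1# + - 1#)
      ≈⟨ solve 2 (λ p I → (:- (con (+ 2) :* p :* I)) :+ (con (+ 4) :* p :* I) :* (con (+ 1) :- con (+ 1))
                          := :- (con (+ 2) :* p :* I)) refl p I ⟩
    - (2# * p * I) ∎
    where
    p = ⟨ v , α ⟩
    N = ⟨ α , α ⟩
    I = N ⁻¹
    4′ = 1# + (1# + (1# + 1#))

  reflect-involutive : ∀ {α} v → ¬ (⟨ α , α ⟩ ≈ 0#) → reflect α (reflect α v) ≈V v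
  reflect-involutive {α} v α≉0 i = trans (+-cong refl (-‿cong (*-cong (pairing-reflect v α≉0) refl)))
    (solve 3 (λ a k x → (a :+ (:- (k :* x))) :+ (:- ((:- k) :* x)) := a) refl (v i) (pairing α v) (α i))

  reflect-isometry : ∀ {α} u w → ¬ (⟨ α , α ⟩ ≈ 0#) → ⟨ reflect α u , reflect α w ⟩ ≈ ⟨ u , w ⟩
  reflect-isometry {α} u w α≉0 = begin
    ⟨ reflect α u , reflect α w ⟩  ≈⟨ ⟨⟩-cong (reflect-as-sum α u) (reflect-as-sum α w) ⟩
    ⟨ u′ , w′ ⟩                    ≈⟨ ⟨⟩-linearˡ u a α w′ ⟩
    ⟨ u , w′ ⟩ + a * ⟨ α , w′ ⟩
      ≈⟨ +-cong (trans (⟨⟩-sym u w′) (⟨⟩-linearˡ w b α u)) (*-cong refl (trans (⟨⟩-sym α w′) (⟨⟩-linearˡ w b α α))) ⟩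
    (⟨ w , u ⟩ + b * ⟨ α , u ⟩) + a * (⟨ w , α ⟩ + b * N)
      ≈⟨ +-cong (+-cong (⟨⟩-sym w u) (*-cong refl (⟨⟩-sym α u))) refl ⟩
    (X + b * pu) + a * (pw + b * N)
      ≈⟨ solve 5 (λ X pu pw N I →
            (X :+ (:- (con (+ 2) :* pw :* I)) :* pu) :+ (:- (con (+ 2) :* pu :* I)) :* (pw :+ (:- (con (+ 2) :* pw :* I)) :* N)
            := X :+ (con (+ 4) :* pu :* pw :* I) :* (N :* I :- con (+ 1))) refl X pu pw N I ⟩
    X + 4′ * pu * pw * I * (N * I + - 1#) ≈⟨ +-cong refl (*-cong refl (+-cong (⁻¹-inverseʳ N α≉0) refl)) ⟩
    X + 4′ * pu * pw * I * (1# + - 1#)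
      ≈⟨ solve 4 (λ X pu pw I → X :+ (con (+ 4) :* pu :* pw :* I) :* (con (+ 1) :- con (+ 1)) := X) refl X pu pw I ⟩
    X ∎
    where
    N = ⟨ α , α ⟩
    I = N ⁻¹
    pu = ⟨ u , α ⟩
    pw = ⟨ w , α ⟩
    X = ⟨ u , w ⟩
    a = - pairing α u
    b = - pairing α w
    u′ = λ i → u i + a * α i
    w′ = λ i → w i + b * α i
    4′ = 1# + (1# + (1# + 1#))

module ListLength {A : Set} where
  open ℕ.≤-Reasoning

  length-insert : ∀ (a b : List A) x u → suc (length a) ≡ length b → length (a ++ x ∷ u) ≡ length (b ++ u)
  length-insert a b x u ∣b∣≡1+∣a∣ = begin-equality
    length (a ++ x ∷ u)        ≡⟨ List.length-++ a ⟩
    length a ℕ.+ suc (length u) ≡⟨ ℕ.+-suc (length a) (length u) ⟩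
    suc (length a) ℕ.+ length u ≡⟨ ≡.cong (ℕ._+ length u) ∣b∣≡1+∣a∣ ⟩
    length b ℕ.+ length u       ≡⟨ List.length-++ b ⟨
    length (b ++ u) ∎

  length-++-congˡ : ∀ p {c d : List A} → length c ≡ length d → length (p ++ c) ≡ length (p ++ d)
  length-++-congˡ p {c} {d} ∣c∣≡∣d∣ = begin-equality
    length (p ++ c)        ≡⟨ List.length-++ p ⟩
    length p ℕ.+ length c  ≡⟨ ≡.cong (length p ℕ.+_) ∣c∣≡∣d∣ ⟩
    length p ℕ.+ length d  ≡⟨ List.length-++ p ⟨
    length (p ++ d) ∎

  length-delete : ∀ (a b : List A) x u → suc (length a) ≡ length b → length (a ++ u) ℕ.< length (b ++ x ∷ u)
  length-delete a b x u ∣b∣≡1+∣a∣ = begin-strict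
    length (a ++ u)            ≡⟨ List.length-++ a ⟩
    length a ℕ.+ length u      <⟨ ℕ.+-monoˡ-< (length u) (ℕ.n<1+n (length a)) ⟩
    suc (length a) ℕ.+ length u ≤⟨ ℕ.+-monoʳ-≤ (suc (length a)) (ℕ.n≤1+n (length u)) ⟩
    suc (length a) ℕ.+ suc (length u) ≡⟨ ≡.cong (ℕ._+ suc (length u)) ∣b∣≡1+∣a∣ ⟩
    length b ℕ.+ length (x ∷ u) ≡⟨ List.length-++ b ⟨
    length (b ++ x ∷ u) ∎

module RootSystemProperties {F : OrderedField} {n : ℕ} (R : RootSystem F n) where
  open OrderedField F
  open RS R
  open OrderedFieldProperties F
  open EuclideanSpace F n
  open IntegerCoefficients F using (solve; _:=_; _:+_; _:*_; :-_; con)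
  open IsCommutativeRing isCommutativeRing using (refl; sym; trans; reflexive; +-cong; *-cong; -‿cong)
  open Setoid ≈V-setoid using () renaming (refl to ≈V-refl; sym to ≈V-sym; trans to ≈V-trans; reflexive to ≈V-reflexive)
  module ≈V-Reasoning = Relation.Binary.Reasoning.Setoid ≈V-setoid

  simple-nondegenerate : ∀ s → ¬ (⟨ simple s , simple s ⟩ ≈ 0#)
  simple-nondegenerate s = ≉0V⇒⟨⟩≉0 (nonzero (simple s) (simple∈ s))

  act-cong : ∀ w {u v} → u ≈V v → act w u ≈V act w v
  act-cong []      u≈v = u≈v
  act-cong (s ∷ w) u≈v = reflect-cong (simple s) (act-cong w u≈v)

  act-linear : ∀ w u c v → act w (λ i → u i + c * v i) ≈V (λ i → act w u i + c * act w v i)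
  act-linear []      u c v = ≈V-refl
  act-linear (s ∷ w) u c v = ≈V-trans (reflect-cong (simple s) (act-linear w u c v)) (reflect-linear (simple s) _ c _)

  act-isometry : ∀ w u v → ⟨ act w u , act w v ⟩ ≈ ⟨ u , v ⟩
  act-isometry []      u v = refl
  act-isometry (s ∷ w) u v = trans (reflect-isometry _ _ (simple-nondegenerate s)) (act-isometry w u v)

  act-neg : ∀ w v → act w (negV v) ≈V negV (act w v)
  act-neg []      v = ≈V-refl
  act-neg (s ∷ w) v = ≈V-trans (reflect-cong (simple s) (act-neg w v)) (reflect-neg (simple s) _)

  act-++ : ∀ x y v → act (x ++ y) v ≡ act x (act y v)
  act-++ []      y v = ≡.refl
  act-++ (s ∷ x) y v = ≡.cong (reflect (simple s)) (act-++ x y v)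

  act-reverse : ∀ s w v → act (reverse (s ∷ w)) v ≡ act (reverse w) (reflect (simple s) v)
  act-reverse s w v = ≡.trans (≡.cong (λ x → act x v) (List.unfold-reverse s w)) (act-++ (reverse w) [ s ] v)

  act-reverse-inverseˡ : ∀ w v → act (reverse w) (act w v) ≈V v
  act-reverse-inverseˡ []      v = ≈V-refl
  act-reverse-inverseˡ (s ∷ w) v = begin
    act (reverse (s ∷ w)) (act (s ∷ w) v)                    ≡⟨ act-reverse s w _ ⟩
    act (reverse w) (reflect (simple s) (act (s ∷ w) v))
      ≈⟨ act-cong (reverse w) (reflect-involutive _ (simple-nondegenerate s)) ⟩
    act (reverse w) (act w v)                                ≈⟨ act-reverse-inverseˡ w v ⟩
    v ∎
    where open ≈V-Reasoning

  act-reverse-inverseʳ : ∀ w v → act w (act (reverse w) v) ≈V v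
  act-reverse-inverseʳ []      v = ≈V-refl
  act-reverse-inverseʳ (s ∷ w) v = begin
    act (s ∷ w) (act (reverse (s ∷ w)) v)                          ≡⟨ ≡.cong (act (s ∷ w)) (act-reverse s w v) ⟩
    reflect (simple s) (act w (act (reverse w) (reflect (simple s) v))) ≈⟨ reflect-cong (simple s) (act-reverse-inverseʳ w _) ⟩
    reflect (simple s) (reflect (simple s) v)                      ≈⟨ reflect-involutive v (simple-nondegenerate s) ⟩
    v ∎
    where open ≈V-Reasoning

  -- _≡W_ is wrapped in a record so that both words can be inferred by unification.
  infix 4 _≈W_
  record _≈W_ (x y : Word) : Set where
    constructor mk≈W
    field act-≈ : x ≡W y
  open _≈W_ public

  ≈W-setoid : Setoid 0ℓ 0ℓ
  ≈W-setoid = record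
    { Carrier = Word ; _≈_ = _≈W_
    ; isEquivalence = record
      { refl  = mk≈W (λ v → ≈V-refl)
      ; sym   = λ x≈y → mk≈W (λ v → ≈V-sym (act-≈ x≈y v))
      ; trans = λ x≈y y≈z → mk≈W (λ v → ≈V-trans (act-≈ x≈y v) (act-≈ y≈z v)) } }

  open Setoid ≈W-setoid using () renaming (refl to ≈W-refl; sym to ≈W-sym; trans to ≈W-trans; reflexive to ≈W-reflexive)
  module ≈W-Reasoning = Relation.Binary.Reasoning.Setoid ≈W-setoid

  ++-congW : ∀ {x x′ y y′} → x ≈W x′ → y ≈W y′ → x ++ y ≈W x′ ++ y′
  ++-congW {x} {x′} {y} {y′} x≈x′ y≈y′ = mk≈W λ v → begin
    act (x ++ y) v      ≡⟨ act-++ x y v ⟩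
    act x (act y v)     ≈⟨ act-cong x (act-≈ y≈y′ v) ⟩
    act x (act y′ v)    ≈⟨ act-≈ x≈x′ (act y′ v) ⟩
    act x′ (act y′ v)   ≡⟨ act-++ x′ y′ v ⟨
    act (x′ ++ y′) v ∎
    where open ≈V-Reasoning

  ++-congˡ-W : ∀ x {y y′} → y ≈W y′ → x ++ y ≈W x ++ y′
  ++-congˡ-W x = ++-congW ≈W-refl

  ++-congʳ-W : ∀ {x x′} y → x ≈W x′ → x ++ y ≈W x′ ++ y
  ++-congʳ-W y x≈x′ = ++-congW x≈x′ ≈W-refl

  ∷-congW : ∀ s {x y} → x ≈W y → s ∷ x ≈W s ∷ y
  ∷-congW s = ++-congˡ-W [ s ]

  ss≈W : ∀ s w → s ∷ s ∷ w ≈W w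
  ss≈W s w = mk≈W λ v → reflect-involutive (act w v) (simple-nondegenerate s)

  ++-cancelʳ-W : ∀ x y z → x ++ z ≈W y ++ z → x ≈W y
  ++-cancelʳ-W x y z xz≈yz = mk≈W λ v → begin
    act x v                            ≈⟨ act-cong x (act-reverse-inverseʳ z v) ⟨
    act x (act z (act (reverse z) v))  ≡⟨ act-++ x z _ ⟨
    act (x ++ z) (act (reverse z) v)   ≈⟨ act-≈ xz≈yz _ ⟩
    act (y ++ z) (act (reverse z) v)   ≡⟨ act-++ y z _ ⟩
    act y (act z (act (reverse z) v))  ≈⟨ act-cong y (act-reverse-inverseʳ z v) ⟩
    act y v ∎
    where open ≈V-Reasoning

  IsNegativeRoot : V → Set
  IsNegativeRoot v = (v ∈L roots) × NonNegComb simple (negV v)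

  ∈L-resp : ∀ {u v} → u ≈V v → u ∈L roots → v ∈L roots
  ∈L-resp u≈v = Any.map (λ u≈x i → trans (sym (u≈v i)) (u≈x i))

  NonNegComb-resp : ∀ {u v} → u ≈V v → NonNegComb simple u → NonNegComb simple v
  NonNegComb-resp u≈v (c , 0≤c , u≈Σ) = c , 0≤c , ≈V-trans (≈V-sym u≈v) u≈Σ

  IsPositiveRoot-resp : ∀ {u v} → u ≈V v → IsPositiveRoot u → IsPositiveRoot v
  IsPositiveRoot-resp u≈v (u∈Φ , u≥0) = ∈L-resp u≈v u∈Φ , NonNegComb-resp u≈v u≥0

  IsNegativeRoot-resp : ∀ {u v} → u ≈V v → IsNegativeRoot u → IsNegativeRoot v
  IsNegativeRoot-resp u≈v (u∈Φ , -u≥0) = ∈L-resp u≈v u∈Φ , NonNegComb-resp (λ i → -‿cong (u≈v i)) -u≥0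

  positive⊎negative : ∀ {v} → v ∈L roots → IsPositiveRoot v ⊎ IsNegativeRoot v
  positive⊎negative {v} v∈Φ = Sum.map (v∈Φ ,_) (v∈Φ ,_) (simple-sign v v∈Φ)

  ¬positive∧negative : ∀ {v} → IsPositiveRoot v → IsNegativeRoot v → ⊥
  ¬positive∧negative {v} (v∈Φ , c , 0≤c , v≈Σc) (_ , d , 0≤d , -v≈Σd) = nonzero v v∈Φ v≈0
    where
    Σ[c+d]≈0 : lincomb simple (λ j → c j + d j) ≈V 0V
    Σ[c+d]≈0 i = trans (lincomb-+ simple c d i)
      (trans (+-cong (sym (v≈Σc i)) (sym (-v≈Σd i))) (solve 1 (λ x → x :+ (:- x) := con (+ 0)) refl (v i)))
    c≈0 : ∀ j → c j ≈ 0#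
    c≈0 j = nonneg-+≈0⇒≈0 (0≤c j) (0≤d j) (simple-indep _ Σ[c+d]≈0 j)
    v≈0 : v ≈V 0V
    v≈0 i = trans (v≈Σc i) (trans (sumF-cong (λ j → *-cong (c≈0 j) refl)) (sumF-0* (λ j → simple j i)))

  act-root : ∀ w {v} → v ∈L roots → act w v ∈L roots
  act-root []      v∈Φ = v∈Φ
  act-root (s ∷ w) v∈Φ = closed (simple s) _ (simple∈ s) (act-root w v∈Φ)

  simple-positive : ∀ s → IsPositiveRoot (simple s)
  simple-positive s = simple∈ s , single s 1# , single-nonneg s 0≤1 ,
    (λ i → sym (trans (lincomb-single simple s 1# i) (solve 1 (λ x → con (+ 1) :* x := x) refl (simple s i))))

  reflect-positive-negative⇒simple : ∀ s {β} → IsPositiveRoot β → IsNegativeRoot (reflect (simple s) β) → β ≈V simple s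
  reflect-positive-negative⇒simple s {β} (β∈Φ , c , 0≤c , β≈Σc) (_ , d , 0≤d , -sβ≈Σd) i =
    trans (β≈cₛα i) (trans (*-cong cₛ≈1 refl) (solve 1 (λ x → con (+ 1) :* x := x) refl (α i)))
    where
    α = simple s
    k = pairing α β
    e : Fin rank → Carrier
    e j = (c j + d j) + - single s k j
    -- Σ (c_j + d_j) α_j = β − s_α β = k α, so independence forces c_j = 0 for j ≠ s.
    Σe≈0 : lincomb simple e ≈V 0V
    Σe≈0 = begin
      lincomb simple e
        ≈⟨ lincomb-+ simple _ _ ⟩
      (λ i → lincomb simple (λ j → c j + d j) i + lincomb simple (λ j → - single s k j) i)
        ≈⟨ (λ i → +-cong (lincomb-+ simple c d i)
                         (trans (lincomb-neg simple (single s k) i) (-‿cong (lincomb-single simple s k i)))) ⟩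
      (λ i → (lincomb simple c i + lincomb simple d i) + - (k * α i))
        ≈⟨ (λ i → +-cong (+-cong (sym (β≈Σc i)) (sym (-sβ≈Σd i))) refl) ⟩
      (λ i → (β i + - (β i + - (k * α i))) + - (k * α i))
        ≈⟨ (λ i → solve 2 (λ b x → (b :+ (:- (b :+ (:- x)))) :+ (:- x) := con (+ 0)) refl (β i) (k * α i)) ⟩
      0V ∎
      where open ≈V-Reasoning
    c-off-s≈0 : ∀ {j} → j ≢ s → c j ≈ 0#
    c-off-s≈0 {j} j≢s = nonneg-+≈0⇒≈0 (0≤c j) (0≤d j)
      (trans (solve 1 (λ x → x := x :+ (:- con (+ 0))) refl (c j + d j))
        (trans (reflexive (≡.cong (λ z → c j + d j + - z) (≡.sym (single-≢ k j≢s)))) (simple-indep e Σe≈0 j)))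
    c≈single : ∀ j → c j ≈ single s (c s) j
    c≈single j with j Fin.≟ s
    ... | yes ≡.refl = reflexive (≡.sym (single-≡ j (c j)))
    ... | no j≢s     = trans (c-off-s≈0 j≢s) (reflexive (≡.sym (single-≢ (c s) j≢s)))
    β≈cₛα : β ≈V (λ i → c s * α i)
    β≈cₛα = ≈V-trans β≈Σc (≈V-trans (lincomb-cong simple c≈single) (lincomb-single simple s (c s)))
    cₛ≈1 : c s ≈ 1#
    cₛ≈1 = nonneg-±1⇒1 (0≤c s) (reduced α (c s) (simple∈ s) (∈L-resp β≈cₛα β∈Φ))

  act-pairing : ∀ x {s t} v → act x (simple s) ≈V simple t → pairing (simple t) (act x v) ≈ pairing (simple s) v
  act-pairing x {s} {t} v xαₛ≈αₜ = *-cong (*-cong refl ⟨xv,αₜ⟩≈⟨v,αₛ⟩) (⁻¹-cong (simple-nondegenerate t) ⟨αₜ,αₜ⟩≈⟨αₛ,αₛ⟩)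
    where
    ⟨xv,αₜ⟩≈⟨v,αₛ⟩ : ⟨ act x v , simple t ⟩ ≈ ⟨ v , simple s ⟩
    ⟨xv,αₜ⟩≈⟨v,αₛ⟩ = trans (⟨⟩-cong ≈V-refl (≈V-sym xαₛ≈αₜ)) (act-isometry x v (simple s))
    ⟨αₜ,αₜ⟩≈⟨αₛ,αₛ⟩ : ⟨ simple t , simple t ⟩ ≈ ⟨ simple s , simple s ⟩
    ⟨αₜ,αₜ⟩≈⟨αₛ,αₛ⟩ = trans (⟨⟩-cong (≈V-sym xαₛ≈αₜ) (≈V-sym xαₛ≈αₜ)) (act-isometry x (simple s) (simple s))

  -- x s x⁻¹ is the reflection in the root x αₛ
  conjugate : ∀ x {s t} → act x (simple s) ≈V simple t → t ∷ x ≈W x ++ [ s ]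
  conjugate x {s} {t} xαₛ≈αₜ = mk≈W λ v → begin
    reflect αₜ (act x v)                                   ≈⟨ reflect-as-sum αₜ (act x v) ⟩
    (λ i → act x v i + - pairing αₜ (act x v) * αₜ i)
      ≈⟨ (λ i → +-cong refl (*-cong (-‿cong (act-pairing x v xαₛ≈αₜ)) (sym (xαₛ≈αₜ i)))) ⟩
    (λ i → act x v i + - pairing αₛ v * act x αₛ i)        ≈⟨ act-linear x v _ αₛ ⟨
    act x (λ i → v i + - pairing αₛ v * αₛ i)              ≈⟨ act-cong x (reflect-as-sum αₛ v) ⟨
    act x (reflect αₛ v)                                   ≡⟨ act-++ x [ s ] v ⟨
    act (x ++ [ s ]) v ∎
    where
    open ≈V-Reasoning
    αₛ = simple s
    αₜ = simple t

  conjugate′ : ∀ x {s t} → act x (simple s) ≈V simple t → x ≈W t ∷ x ++ [ s ]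
  conjugate′ x {s} {t} xαₛ≈αₜ = begin
    x                 ≈⟨ ss≈W t x ⟨
    t ∷ t ∷ x         ≈⟨ ∷-congW t (conjugate x xαₛ≈αₜ) ⟩
    t ∷ x ++ [ s ] ∎
    where open ≈W-Reasoning

  exchange : ∀ w s → IsNegativeRoot (act w (simple s)) →
             Σ Word λ w′ → suc (length w′) ≡ length w × w′ ≈W w ++ [ s ]
  exchange []      s αₛ<0 = ⊥-elim (¬positive∧negative (simple-positive s) αₛ<0)
  exchange (a ∷ w) s awαₛ<0 with positive⊎negative (act-root w (simple∈ s))
  ... | inj₂ wαₛ<0 = let w′ , ∣w′∣ , w′≈ws = exchange w s wαₛ<0 in a ∷ w′ , ≡.cong suc ∣w′∣ , ∷-congW a w′≈ws
  ... | inj₁ wαₛ>0 = w , ≡.refl , conjugate′ w (reflect-positive-negative⇒simple a wαₛ>0 awαₛ<0)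

  IsReduced : Word → Set
  IsReduced u = ∀ v → v ≈W u → length u ℕ.≤ length v

  reduced⇒positive : ∀ w s u → IsReduced (w ++ s ∷ u) → IsPositiveRoot (act w (simple s))
  reduced⇒positive w s u w·s·u-reduced with positive⊎negative (act-root w (simple∈ s))
  ... | inj₁ wαₛ>0 = wαₛ>0
  ... | inj₂ wαₛ<0 = ⊥-elim (ℕ.<⇒≱ (length-delete w′ w s u ∣w′∣<∣w∣) (w·s·u-reduced (w′ ++ u) w′u≈w·s·u))
    where
    open ListLength
    w′ = proj₁ (exchange w s wαₛ<0)
    ∣w′∣<∣w∣ = proj₁ (proj₂ (exchange w s wαₛ<0))
    w′u≈w·s·u : w′ ++ u ≈W w ++ s ∷ u
    w′u≈w·s·u = ≈W-trans (++-congʳ-W u (proj₂ (proj₂ (exchange w s wαₛ<0)))) (≈W-reflexive (List.++-assoc w [ s ] u))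

  suffixComplWord : ∀ {m} → Vec S m → Subset m → Fin m → Word
  suffixComplWord (q ∷ Q) (b ∷ I) zero    = complWord Q I
  suffixComplWord (q ∷ Q) (b ∷ I) (suc k) = suffixComplWord Q I k

  complWord-split-∈ : ∀ {m} (Q : Vec S m) {I k} → k ∈ I →
                      complWord Q I ≡ prefixComplWord Q I k ++ suffixComplWord Q I k
  complWord-split-∈ (q ∷ Q) {inside  ∷ I} here      = ≡.refl
  complWord-split-∈ (q ∷ Q) {outside ∷ I} (there p) = ≡.cong (q ∷_) (complWord-split-∈ Q p)
  complWord-split-∈ (q ∷ Q) {inside  ∷ I} (there p) = complWord-split-∈ Q p

  complWord-split-∉ : ∀ {m} (Q : Vec S m) {I k} → I [ k ]= outside →
                      complWord Q I ≡ prefixComplWord Q I k ++ lookup Q k ∷ suffixComplWord Q I k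
  complWord-split-∉ (q ∷ Q) {outside ∷ I} here      = ≡.refl
  complWord-split-∉ (q ∷ Q) {outside ∷ I} (there p) = ≡.cong (q ∷_) (complWord-split-∉ Q p)
  complWord-split-∉ (q ∷ Q) {inside  ∷ I} (there p) = complWord-split-∉ Q p

  prefixComplWord-update-≥ : ∀ {m} (Q : Vec S m) I {j k} b → k Fin.≤ j →
                              prefixComplWord Q (I [ j ]≔ b) k ≡ prefixComplWord Q I k
  prefixComplWord-update-≥ (q ∷ Q) (c ∷ I)       {zero}  {zero}  b k≤j = ≡.refl
  prefixComplWord-update-≥ (q ∷ Q) (c ∷ I)       {suc j} {zero}  b k≤j = ≡.refl
  prefixComplWord-update-≥ (q ∷ Q) (outside ∷ I) {suc j} {suc k} b (ℕ.s≤s k≤j) =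
    ≡.cong (q ∷_) (prefixComplWord-update-≥ Q I b k≤j)
  prefixComplWord-update-≥ (q ∷ Q) (inside ∷ I)  {suc j} {suc k} b (ℕ.s≤s k≤j) = prefixComplWord-update-≥ Q I b k≤j

  suffixComplWord-update-≤ : ∀ {m} (Q : Vec S m) I {j k} b → j Fin.≤ k →
                              suffixComplWord Q (I [ j ]≔ b) k ≡ suffixComplWord Q I k
  suffixComplWord-update-≤ (q ∷ Q) (c ∷ I) {zero}  {zero}  b j≤k         = ≡.refl
  suffixComplWord-update-≤ (q ∷ Q) (c ∷ I) {zero}  {suc k} b j≤k         = ≡.refl
  suffixComplWord-update-≤ (q ∷ Q) (c ∷ I) {suc j} {suc k} b (ℕ.s≤s j≤k) = suffixComplWord-update-≤ Q I b j≤k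

  record PrefixDeletion {m} (Q : Vec S m) (I : Subset m) (k : Fin m) (t : S) : Set where
    field
      position   : Fin m
      position<k : position Fin.< k
      position∉I : I [ position ]= outside
      deleted-≈W : prefixComplWord Q (I [ position ]≔ inside) k ≈W prefixComplWord Q I k ++ [ t ]
      deleted-length : suc (length (prefixComplWord Q (I [ position ]≔ inside) k)) ≡ length (prefixComplWord Q I k)

  PrefixDeletion-∷ : ∀ {m} {Q : Vec S m} {I k t} q b → PrefixDeletion Q I k t → PrefixDeletion (q ∷ Q) (b ∷ I) (suc k) t
  PrefixDeletion-∷ q inside d = record
    { position = suc position ; position<k = ℕ.s≤s position<k ; position∉I = there position∉I
    ; deleted-≈W = deleted-≈W ; deleted-length = deleted-length }
    where open PrefixDeletion d
  PrefixDeletion-∷ q outside d = record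
    { position = suc position ; position<k = ℕ.s≤s position<k ; position∉I = there position∉I
    ; deleted-≈W = ∷-congW q deleted-≈W ; deleted-length = ≡.cong suc deleted-length }
    where open PrefixDeletion d

  prefix-exchange : ∀ {m} (Q : Vec S m) I k t → IsNegativeRoot (act (prefixComplWord Q I k) (simple t)) →
                    PrefixDeletion Q I k t
  prefix-exchange (q ∷ Q) (b ∷ I) zero t αₜ<0 = ⊥-elim (¬positive∧negative (simple-positive t) αₜ<0)
  prefix-exchange (q ∷ Q) (inside ∷ I) (suc k) t wαₜ<0 = PrefixDeletion-∷ q inside (prefix-exchange Q I k t wαₜ<0)
  prefix-exchange (q ∷ Q) (outside ∷ I) (suc k) t qwαₜ<0 with positive⊎negative (act-root (prefixComplWord Q I k) (simple∈ t))
  ... | inj₂ wαₜ<0 = PrefixDeletion-∷ q outside (prefix-exchange Q I k t wαₜ<0)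
  ... | inj₁ wαₜ>0 = record
    { position = zero ; position<k = ℕ.s≤s ℕ.z≤n ; position∉I = here
    ; deleted-≈W = conjugate′ (prefixComplWord Q I k) (reflect-positive-negative⇒simple q wαₜ>0 qwαₜ<0)
    ; deleted-length = ≡.refl }

  -- Deletion on the left of Q_{[m] ∖ I}, carrying the already traversed letters x with x γ = αₜ.
  complWord-exchangeˡ : ∀ {m} (Q : Vec S m) I x t γ → act x γ ≈V simple t → IsPositiveRoot γ →
    IsNegativeRoot (act (reverse (complWord Q I)) γ) →
    Σ (Fin m) λ j → I [ j ]= outside × x ++ complWord Q (I [ j ]≔ inside) ≈W t ∷ x ++ complWord Q I
                    × suc (length (complWord Q (I [ j ]≔ inside))) ≡ length (complWord Q I)
  complWord-exchangeˡ [] [] x t γ xγ≈αₜ γ>0 γ<0 = ⊥-elim (¬positive∧negative γ>0 γ<0)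
  complWord-exchangeˡ (q ∷ Q) (inside ∷ I) x t γ xγ≈αₜ γ>0 w⁻¹γ<0 =
    let j , j∉I , deleted-≈W , deleted-length = complWord-exchangeˡ Q I x t γ xγ≈αₜ γ>0 w⁻¹γ<0
    in suc j , there j∉I , deleted-≈W , deleted-length
  complWord-exchangeˡ (q ∷ Q) (outside ∷ I) x t γ xγ≈αₜ γ>0 w⁻¹γ<0
    with positive⊎negative (closed (simple q) γ (simple∈ q) (proj₁ γ>0))
  ... | inj₁ sγ>0 =
    let j , j∉I , deleted-≈W , deleted-length =
          complWord-exchangeˡ Q I (x ++ [ q ]) t (reflect (simple q) γ) xqsγ≈αₜ sγ>0
            (IsNegativeRoot-resp (≈V-reflexive (act-reverse q (complWord Q I) γ)) w⁻¹γ<0)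
    in suc j , there j∉I , reassociate deleted-≈W , ≡.cong suc deleted-length
    where
    xqsγ≈αₜ : act (x ++ [ q ]) (reflect (simple q) γ) ≈V simple t
    xqsγ≈αₜ = ≈V-trans (≈V-reflexive (act-++ x [ q ] _))
                (≈V-trans (act-cong x (reflect-involutive γ (simple-nondegenerate q))) xγ≈αₜ)
    reassociate : ∀ {u v} → (x ++ [ q ]) ++ u ≈W t ∷ (x ++ [ q ]) ++ v → x ++ q ∷ u ≈W t ∷ x ++ q ∷ v
    reassociate {u} {v} e = ≈W-trans (≈W-reflexive (≡.sym (List.++-assoc x [ q ] u)))
                              (≈W-trans e (≈W-reflexive (≡.cong (t ∷_) (List.++-assoc x [ q ] v))))
  ... | inj₂ sγ<0 = zero , here , x·C≈t·x·q·C , ≡.refl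
    where
    C = complWord Q I
    γ≈αq : γ ≈V simple q
    γ≈αq = reflect-positive-negative⇒simple q γ>0 sγ<0
    x·C≈t·x·q·C : x ++ C ≈W t ∷ x ++ q ∷ C
    x·C≈t·x·q·C = begin
      x ++ C                 ≈⟨ ++-congˡ-W x (ss≈W q C) ⟨
      x ++ q ∷ q ∷ C         ≡⟨ List.++-assoc x [ q ] (q ∷ C) ⟨
      (x ++ [ q ]) ++ q ∷ C  ≈⟨ ++-congʳ-W (q ∷ C) (conjugate x (≈V-trans (act-cong x (≈V-sym γ≈αq)) xγ≈αₜ)) ⟨
      t ∷ x ++ q ∷ C ∎
      where open ≈W-Reasoning

  record SuffixDeletion {m} (Q : Vec S m) (I : Subset m) (k : Fin m) (t : S) : Set where
    field
      position   : Fin m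
      k<position : k Fin.< position
      position∉I : I [ position ]= outside
      deleted-≈W : suffixComplWord Q (I [ position ]≔ inside) k ≈W t ∷ suffixComplWord Q I k
      deleted-length : suc (length (suffixComplWord Q (I [ position ]≔ inside) k)) ≡ length (suffixComplWord Q I k)

  suffix-exchange : ∀ {m} (Q : Vec S m) I k t → IsNegativeRoot (act (reverse (suffixComplWord Q I k)) (simple t)) →
                    SuffixDeletion Q I k t
  suffix-exchange (q ∷ Q) (b ∷ I) zero t w⁻¹αₜ<0 =
    let j , j∉I , deleted-≈W , deleted-length =
          complWord-exchangeˡ Q I [] t (simple t) ≈V-refl (simple-positive t) w⁻¹αₜ<0
    in record { position = suc j ; k<position = ℕ.s≤s ℕ.z≤n ; position∉I = there j∉I
              ; deleted-≈W = deleted-≈W ; deleted-length = deleted-length }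
  suffix-exchange (q ∷ Q) (b ∷ I) (suc k) t w⁻¹αₜ<0 = record
    { position = suc position ; k<position = ℕ.s≤s k<position ; position∉I = there position∉I
    ; deleted-≈W = deleted-≈W ; deleted-length = deleted-length }
    where open SuffixDeletion (suffix-exchange Q I k t w⁻¹αₜ<0)

  swap : ∀ {m} → Subset m → Fin m → Fin m → Subset m
  swap I i j = (I [ j ]≔ inside) [ i ]≔ outside

  swap-flip : ∀ {m} (I : Subset m) {i j} → i ≢ j → i ∈ I → I [ j ]= outside → Flip I (swap I i j) i j
  swap-flip I {i} {j} i≢j i∈I j∉I = i∈I , j∈J , i≢j , λ k → I⇒J k , J⇒I k
    where
    I′ = I [ j ]≔ inside
    J  = swap I i j
    j∈J : j ∈ J
    j∈J = Vec.lookup⇒[]= j J (≡.trans (Vec.lookup∘update′ (i≢j ∘ ≡.sym) I′ outside) (Vec.lookup∘update j I inside))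
    I⇒J : ∀ k → k ∈ I × k ≢ i → k ∈ J × k ≢ j
    I⇒J k (k∈I , k≢i) = Vec.lookup⇒[]= k J (≡.trans (Vec.lookup∘update′ k≢i I′ outside)
                            (≡.trans (Vec.lookup∘update′ k≢j I inside) (Vec.[]=⇒lookup k∈I))) , k≢j
      where
      k≢j : k ≢ j
      k≢j ≡.refl with ≡.trans (≡.sym (Vec.[]=⇒lookup k∈I)) (Vec.[]=⇒lookup j∉I)
      ... | ()
    J⇒I : ∀ k → k ∈ J × k ≢ j → k ∈ I × k ≢ i
    J⇒I k (k∈J , k≢j) = Vec.lookup⇒[]= k I (≡.trans (≡.sym (Vec.lookup∘update′ k≢j I inside))
                            (≡.trans (≡.sym (Vec.lookup∘update′ k≢i I′ outside)) (Vec.[]=⇒lookup k∈J))) , k≢i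
      where
      k≢i : k ≢ i
      k≢i ≡.refl with ≡.trans (≡.sym (Vec.[]=⇒lookup k∈J)) (Vec.lookup∘update i I′ outside)
      ... | ()

  Flip-sym : ∀ {m} {I J : Subset m} {i j} → Flip I J i j → Flip J I j i
  Flip-sym (i∈I , j∈J , i≢j , I⇔J) = j∈J , i∈I , i≢j ∘ ≡.sym , λ k → proj₂ (I⇔J k) , proj₁ (I⇔J k)

  complWord-swap : ∀ {m} (Q : Vec S m) I i j →
    complWord Q (swap I i j) ≡ prefixComplWord Q (I [ j ]≔ inside) i ++ lookup Q i ∷ suffixComplWord Q (I [ j ]≔ inside) i
  complWord-swap Q I i j = ≡.trans (complWord-split-∉ Q (Vec.[]≔-updates I′ i))
    (≡.cong₂ (λ u v → u ++ lookup Q i ∷ v) (prefixComplWord-update-≥ Q I′ outside Fin.≤-refl)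
                                           (suffixComplWord-update-≤ Q I′ outside Fin.≤-refl))
    where I′ = I [ j ]≔ inside

  facet-resp : ∀ {m} {Q : Vec S m} {ω} {I J : Subset m} → IsFacet Q ω I → complWord Q J ≈W complWord Q I →
               length (complWord Q J) ≡ length (complWord Q I) → IsFacet Q ω J
  facet-resp (I≡ω , I-minimal) J≈I ∣J∣≡∣I∣ =
    (λ v → ≈V-trans (act-≈ J≈I v) (I≡ω v)) , λ v v≡ω → ≡.subst (ℕ._≤ length v) (≡.sym ∣J∣≡∣I∣) (I-minimal v v≡ω)

  prefix-swap-facet : ∀ {m} {Q : Vec S m} {ω I i} → IsFacet Q ω I → i ∈ I →
                      (d : PrefixDeletion Q I i (lookup Q i)) → IsFacet Q ω (swap I i (PrefixDeletion.position d))
  prefix-swap-facet {Q = Q} {ω} {I} {i} I-facet i∈I d = facet-resp {Q = Q} {ω} {I} {swap I i position} I-facet J≈I ∣J∣≡∣I∣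
    where
    open PrefixDeletion d
    t = lookup Q i
    I′ = I [ position ]≔ inside
    u = suffixComplWord Q I i
    J-split : complWord Q (swap I i position) ≡ prefixComplWord Q I′ i ++ t ∷ u
    J-split = ≡.trans (complWord-swap Q I i position)
                (≡.cong (λ v → prefixComplWord Q I′ i ++ t ∷ v) (suffixComplWord-update-≤ Q I inside (ℕ.<⇒≤ position<k)))
    J≈I : complWord Q (swap I i position) ≈W complWord Q I
    J≈I = begin
      complWord Q (swap I i position)          ≡⟨ J-split ⟩
      prefixComplWord Q I′ i ++ t ∷ u          ≈⟨ ++-congʳ-W (t ∷ u) deleted-≈W ⟩
      (prefixComplWord Q I i ++ [ t ]) ++ t ∷ u ≡⟨ List.++-assoc (prefixComplWord Q I i) [ t ] (t ∷ u) ⟩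
      prefixComplWord Q I i ++ t ∷ t ∷ u       ≈⟨ ++-congˡ-W (prefixComplWord Q I i) (ss≈W t u) ⟩
      prefixComplWord Q I i ++ u               ≡⟨ complWord-split-∈ Q i∈I ⟨
      complWord Q I ∎
      where open ≈W-Reasoning
    ∣J∣≡∣I∣ : length (complWord Q (swap I i position)) ≡ length (complWord Q I)
    ∣J∣≡∣I∣ = ≡.trans (≡.cong length J-split)
                (≡.trans (ListLength.length-insert (prefixComplWord Q I′ i) (prefixComplWord Q I i) t u deleted-length)
                         (≡.cong length (≡.sym (complWord-split-∈ Q i∈I))))

  suffix-swap-facet : ∀ {m} {Q : Vec S m} {ω I i} → IsFacet Q ω I → i ∈ I →
                      (d : SuffixDeletion Q I i (lookup Q i)) → IsFacet Q ω (swap I i (SuffixDeletion.position d))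
  suffix-swap-facet {Q = Q} {ω} {I} {i} I-facet i∈I d = facet-resp {Q = Q} {ω} {I} {swap I i position} I-facet J≈I ∣J∣≡∣I∣
    where
    open SuffixDeletion d
    t = lookup Q i
    I′ = I [ position ]≔ inside
    p = prefixComplWord Q I i
    J-split : complWord Q (swap I i position) ≡ p ++ t ∷ suffixComplWord Q I′ i
    J-split = ≡.trans (complWord-swap Q I i position)
                (≡.cong (λ v → v ++ t ∷ suffixComplWord Q I′ i) (prefixComplWord-update-≥ Q I inside (ℕ.<⇒≤ k<position)))
    J≈I : complWord Q (swap I i position) ≈W complWord Q I
    J≈I = begin
      complWord Q (swap I i position)          ≡⟨ J-split ⟩
      p ++ t ∷ suffixComplWord Q I′ i          ≈⟨ ++-congˡ-W p (∷-congW t deleted-≈W) ⟩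
      p ++ t ∷ t ∷ suffixComplWord Q I i       ≈⟨ ++-congˡ-W p (ss≈W t _) ⟩
      p ++ suffixComplWord Q I i               ≡⟨ complWord-split-∈ Q i∈I ⟨
      complWord Q I ∎
      where open ≈W-Reasoning
    ∣J∣≡∣I∣ : length (complWord Q (swap I i position)) ≡ length (complWord Q I)
    ∣J∣≡∣I∣ = ≡.trans (≡.cong length J-split)
                (≡.trans (ListLength.length-++-congˡ p deleted-length) (≡.cong length (≡.sym (complWord-split-∈ Q i∈I))))

  greedy⇒e∈L : ∀ {m} (Q : Vec S m) ω G → IsGreedy Q ω G → LinExt Q G []
  greedy⇒e∈L Q ω G (G-facet , G-source) i i∈G with positive⊎negative (act-root (prefixComplWord Q G i) (simple∈ (lookup Q i)))
  ... | inj₁ r>0 = _ , r>0 , ≈V-refl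
  ... | inj₂ r<0 = ⊥-elim (G-source (swap G i position) (prefix-swap-facet {Q = Q} {ω} {G} G-facet i∈G d)
                     (position , i , Flip-sym (swap-flip G (Fin.<⇒≢ position<k ∘ ≡.sym) i∈G position∉I) , position<k))
    where
    d = prefix-exchange Q G i (lookup Q i) r<0
    open PrefixDeletion d

  act-reverse-split : ∀ p u {ω} → p ++ u ≈W ω → ∀ v → act (reverse ω) (act p v) ≈V act (reverse u) v
  act-reverse-split p u {ω} pu≈ω v = begin
    act (reverse ω) (act p v)                          ≈⟨ act-cong (reverse ω) (act-cong p (act-reverse-inverseʳ u v)) ⟨
    act (reverse ω) (act p (act u (act (reverse u) v))) ≡⟨ ≡.cong (act (reverse ω)) (act-++ p u _) ⟨
    act (reverse ω) (act (p ++ u) (act (reverse u) v)) ≈⟨ act-cong (reverse ω) (act-≈ pu≈ω _) ⟩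
    act (reverse ω) (act ω (act (reverse u) v))        ≈⟨ act-reverse-inverseˡ ω _ ⟩
    act (reverse u) v ∎
    where open ≈V-Reasoning

  antigreedy⇒ω∈L : ∀ {m} (Q : Vec S m) ω Ḡ → IsAntigreedy Q ω Ḡ → LinExt Q Ḡ ω
  antigreedy⇒ω∈L Q ω Ḡ (Ḡ-facet , Ḡ-sink) i i∈Ḡ
    with positive⊎negative (act-root (reverse ω) (act-root (prefixComplWord Q Ḡ i) (simple∈ (lookup Q i))))
  ... | inj₁ ω⁻¹r>0 = _ , ω⁻¹r>0 , act-reverse-inverseʳ ω _
  ... | inj₂ ω⁻¹r<0 = ⊥-elim (Ḡ-sink (swap Ḡ i position) (suffix-swap-facet {Q = Q} {ω} {Ḡ} Ḡ-facet i∈Ḡ d)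
                        (i , position , swap-flip Ḡ (Fin.<⇒≢ k<position) i∈Ḡ position∉I , k<position))
    where
    split≈ω : prefixComplWord Q Ḡ i ++ suffixComplWord Q Ḡ i ≈W ω
    split≈ω = ≈W-trans (≈W-reflexive (≡.sym (complWord-split-∈ Q i∈Ḡ))) (mk≈W (proj₁ Ḡ-facet))
    d = suffix-exchange Q Ḡ i (lookup Q i)
          (IsNegativeRoot-resp (act-reverse-split (prefixComplWord Q Ḡ i) (suffixComplWord Q Ḡ i) split≈ω _) ω⁻¹r<0)
    open SuffixDeletion d

  facet⇒reduced : ∀ {m} (Q : Vec S m) ω I → IsFacet Q ω I → IsReduced (complWord Q I)
  facet⇒reduced Q ω I (I≡ω , I-minimal) v v≈I = I-minimal v (λ u → ≈V-trans (act-≈ v≈I u) (I≡ω u))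

  -- x = y s gives x αₛ = − y αₛ, while reducedness of y s u makes y αₛ positive.
  reduced-clash : ∀ x y q u → x ++ u ≈W y ++ q ∷ u → IsPositiveRoot (act x (simple q)) → IsReduced (y ++ q ∷ u) → ⊥
  reduced-clash x y q u xu≈yqu xαq>0 yqu-reduced =
    ¬positive∧negative yαq>0 (act-root y (simple∈ q) , NonNegComb-resp xαq≈-yαq (proj₂ xαq>0))
    where
    α = simple q
    yαq>0 = reduced⇒positive y q u yqu-reduced
    x≈yq : x ≈W y ++ [ q ]
    x≈yq = ++-cancelʳ-W x (y ++ [ q ]) u (≈W-trans xu≈yqu (≈W-reflexive (≡.sym (List.++-assoc y [ q ] u))))
    xαq≈-yαq : act x α ≈V negV (act y α)
    xαq≈-yαq = begin
      act x α                   ≈⟨ act-≈ x≈yq α ⟩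
      act (y ++ [ q ]) α        ≡⟨ act-++ y [ q ] α ⟩
      act y (reflect α α)       ≈⟨ act-cong y (reflect-self (simple-nondegenerate q)) ⟩
      act y (negV α)            ≈⟨ act-neg y α ⟩
      negV (act y α) ∎
      where open ≈V-Reasoning

  heads-equal : ∀ {m} q b c (Q : Vec S m) I x y →
    x ++ complWord (q ∷ Q) (b ∷ I) ≈W y ++ complWord (q ∷ Q) (c ∷ I) →
    IsReduced (x ++ complWord (q ∷ Q) (b ∷ I)) → IsReduced (y ++ complWord (q ∷ Q) (c ∷ I)) →
    (b ≡ inside → IsPositiveRoot (act x (simple q))) → (c ≡ inside → IsPositiveRoot (act y (simple q))) → b ≡ c
  heads-equal q inside  inside  Q I x y eq xC-reduced yC-reduced xαq>0 yαq>0 = ≡.refl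
  heads-equal q outside outside Q I x y eq xC-reduced yC-reduced xαq>0 yαq>0 = ≡.refl
  heads-equal q inside  outside Q I x y eq xC-reduced yC-reduced xαq>0 yαq>0 =
    ⊥-elim (reduced-clash x y q (complWord Q I) eq (xαq>0 ≡.refl) yC-reduced)
  heads-equal q outside inside  Q I x y eq xC-reduced yC-reduced xαq>0 yαq>0 =
    ⊥-elim (reduced-clash y x q (complWord Q I) (≈W-sym eq) (yαq>0 ≡.refl) xC-reduced)

  complWord₁ : S → Bool → Word
  complWord₁ q b = complWord (q ∷ []) (b ∷ [])

  complWord-∷ : ∀ {m} x q b (Q : Vec S m) I → x ++ complWord (q ∷ Q) (b ∷ I) ≡ (x ++ complWord₁ q b) ++ complWord Q I
  complWord-∷ x q outside Q I = ≡.sym (List.++-assoc x [ q ] (complWord Q I))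
  complWord-∷ x q inside  Q I = ≡.cong (_++ complWord Q I) (≡.sym (List.++-identityʳ x))

  prefixComplWord-∷ : ∀ {m} x q b (Q : Vec S m) I k →
    x ++ prefixComplWord (q ∷ Q) (b ∷ I) (suc k) ≡ (x ++ complWord₁ q b) ++ prefixComplWord Q I k
  prefixComplWord-∷ x q outside Q I k = ≡.sym (List.++-assoc x [ q ] (prefixComplWord Q I k))
  prefixComplWord-∷ x q inside  Q I k = ≡.cong (_++ prefixComplWord Q I k) (≡.sym (List.++-identityʳ x))

  PositiveRoots : ∀ {m} → Vec S m → Subset m → Word → Set
  PositiveRoots Q I x = ∀ k → k ∈ I → IsPositiveRoot (act (x ++ prefixComplWord Q I k) (simple (lookup Q k)))

  PositiveRoots-tail : ∀ {m} {q b} {Q : Vec S m} {I} x → PositiveRoots (q ∷ Q) (b ∷ I) x →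
                       PositiveRoots Q I (x ++ complWord₁ q b)
  PositiveRoots-tail {q = q} {b} {Q} {I} x x>0 k k∈I =
    ≡.subst (λ z → IsPositiveRoot (act z (simple (lookup Q k)))) (prefixComplWord-∷ x q b Q I k) (x>0 (suc k) (there k∈I))

  PositiveRoots-head : ∀ {m} {q b} {Q : Vec S m} {I} x → PositiveRoots (q ∷ Q) (b ∷ I) x →
                       b ≡ inside → IsPositiveRoot (act x (simple q))
  PositiveRoots-head {q = q} x x>0 ≡.refl =
    ≡.subst (λ z → IsPositiveRoot (act z (simple q))) (List.++-identityʳ x) (x>0 zero here)

  positiveRoots⇒unique : ∀ {m} (Q : Vec S m) I J x y → x ++ complWord Q I ≈W y ++ complWord Q J →
    IsReduced (x ++ complWord Q I) → IsReduced (y ++ complWord Q J) →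
    PositiveRoots Q I x → PositiveRoots Q J y → I ≡ J
  positiveRoots⇒unique [] [] [] x y xI≈yJ xI-reduced yJ-reduced x>0 y>0 = ≡.refl
  positiveRoots⇒unique (q ∷ Q) (b ∷ I) (c ∷ J) x y xI≈yJ xI-reduced yJ-reduced x>0 y>0
    with positiveRoots⇒unique Q I J (x ++ complWord₁ q b) (y ++ complWord₁ q c)
           (≈W-trans (≈W-reflexive (≡.sym (complWord-∷ x q b Q I))) (≈W-trans xI≈yJ (≈W-reflexive (complWord-∷ y q c Q J))))
           (≡.subst IsReduced (complWord-∷ x q b Q I) xI-reduced) (≡.subst IsReduced (complWord-∷ y q c Q J) yJ-reduced)
           (PositiveRoots-tail x x>0) (PositiveRoots-tail y y>0)
  ... | ≡.refl = ≡.cong (_∷ I) (heads-equal q b c Q I x y xI≈yJ xI-reduced yJ-reduced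
                                  (PositiveRoots-head x x>0) (PositiveRoots-head y y>0))

  e∈L⇒greedy : ∀ {m} (Q : Vec S m) ω G → IsGreedy Q ω G → ∀ I → IsFacet Q ω I → LinExt Q I [] → I ≡ G
  e∈L⇒greedy Q ω G G-greedy I I-facet e∈L[I] =
    positiveRoots⇒unique Q I G [] [] (mk≈W (λ v → ≈V-trans (proj₁ I-facet v) (≈V-sym (proj₁ G-facet v))))
      (facet⇒reduced Q ω I I-facet) (facet⇒reduced Q ω G G-facet)
      (linExt-e⇒positive I e∈L[I]) (linExt-e⇒positive G (greedy⇒e∈L Q ω G G-greedy))
    where
    G-facet = proj₁ G-greedy
    linExt-e⇒positive : ∀ J → LinExt Q J [] → PositiveRoots Q J []
    linExt-e⇒positive J e∈L[J] k k∈J = let β , β>0 , β≈r = e∈L[J] k k∈J in IsPositiveRoot-resp β≈r β>0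

lemma5p10 : (F : OrderedField) (n : ℕ) (R : RootSystem F n) →
    let open RS R in
    ∀ {m} (Q : Vec S m) (ω : Word) →
    (∃ λ I → IsFacet Q ω I) →
    (G Ḡ : Subset m) → IsGreedy Q ω G → IsAntigreedy Q ω Ḡ →
    LinExt Q G [] × LinExt Q Ḡ ω × (∀ I → IsFacet Q ω I → LinExt Q I [] → I ≡ G)
lemma5p10 F n R Q ω _ G Ḡ G-greedy Ḡ-antigreedy =
  greedy⇒e∈L Q ω G G-greedy , antigreedy⇒ω∈L Q ω Ḡ Ḡ-antigreedy , e∈L⇒greedy Q ω G G-greedy
  where open RootSystemProperties R
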